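{- Let $q\in\{3,4\}$, $m\ge 1$, and let $\mathcal{T}(t,a,b)$ be a double Toeplitz code over $\mathbb{F}_q$ with $t\in\mathbb{F}_q$, $a,b\in\mathbb{F}_q^{m-1}$. Then there is a double Toeplitz code $\mathcal{T}(t',a',b')$ over $\mathbb{F}_q$ such that (C1) $\mathcal{T}(t,a,b)\cong\mathcal{T}(t',a',b')$, and (C3) the first nonzero component of the vector $(t',a'_1,\dots,a'_{m-1})$ is $1$.
   Context: For $t\in\mathbb{F}_q$, $a=(a_1,\dots,a_{m-1})$, $b=(b_1,\dots,b_{m-1})\in\mathbb{F}_q^{m-1}$, $T(t,a,b)$ is the $m\times m$ matrix whose $(i,j)$ entry is $t$ if $i=j$, $a_{j-i}$ if $j>i$, and $b_{i-j}$ if $i>j$; $\mathcal{T}(t,a,b)$ is the code with generator matrix $(I_m\mid T(t,a,b))$. Codes $C,C'$ of length $N$ are equivalent ($C\cong C'$) if $C'=\{xP:x\in C\}$ for some $N\times N$ monomial matrix $P$ over $\mathbb{F}_q$. -}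

module Defs where

open import Data.Nat using (ℕ; zero; suc; _<_; _+_; _∸_)
open import Data.Fin using (Fin; zero; suc; toℕ; splitAt)
open import Data.Sum using (_⊎_; inj₁; inj₂)
open import Data.Product using (Σ; ∃; _×_; _,_)
open import Relation.Binary.PropositionalEquality using (_≡_)
open import Relation.Nullary using (¬_)
open import Data.Bool using (Bool; true; false; if_then_else_)
open import Data.Nat using (_<ᵇ_)

data Q : Set where
  q3 q4 : Q

data F3 : Set where
  z3 o3 t3 : F3

-- F_4 = {0, 1, w, w²} with w² = w + 1, characteristic 2
data F4 : Set where
  z4 o4 w4 w²4 : F4

𝔽 : Q → Set
𝔽 q3 = F3
𝔽 q4 = F4

add3 : F3 → F3 → F3
add3 z3 y = y
add3 x z3 = x
add3 o3 o3 = t3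
add3 o3 t3 = z3
add3 t3 o3 = z3
add3 t3 t3 = o3

mul3 : F3 → F3 → F3
mul3 z3 y = z3
mul3 o3 y = y
mul3 t3 z3 = z3
mul3 t3 o3 = t3
mul3 t3 t3 = o3

add4 : F4 → F4 → F4
add4 z4 y = y
add4 x z4 = x
add4 o4 o4 = z4
add4 o4 w4 = w²4
add4 o4 w²4 = w4
add4 w4 o4 = w²4
add4 w4 w4 = z4
add4 w4 w²4 = o4
add4 w²4 o4 = w4
add4 w²4 w4 = o4
add4 w²4 w²4 = z4

mul4 : F4 → F4 → F4
mul4 z4 y = z4
mul4 o4 y = y
mul4 w4 z4 = z4
mul4 w4 o4 = w4
mul4 w4 w4 = w²4
mul4 w4 w²4 = o4
mul4 w²4 z4 = z4
mul4 w²4 o4 = w²4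
mul4 w²4 w4 = o4
mul4 w²4 w²4 = w4

0F : (q : Q) → 𝔽 q
0F q3 = z3
0F q4 = z4

1F : (q : Q) → 𝔽 q
1F q3 = o3
1F q4 = o4

addF : (q : Q) → 𝔽 q → 𝔽 q → 𝔽 q
addF q3 = add3
addF q4 = add4

mulF : (q : Q) → 𝔽 q → 𝔽 q → 𝔽 q
mulF q3 = mul3
mulF q4 = mul4

sumF : (q : Q) {n : ℕ} → (Fin n → 𝔽 q) → 𝔽 q
sumF q {zero} f = 0F q
sumF q {suc n} f = addF q (f zero) (sumF q (λ i → f (suc i)))

Vec𝔽 : Q → ℕ → Set
Vec𝔽 q n = Fin n → 𝔽 q

Mat : Q → ℕ → ℕ → Set
Mat q r c = Fin r → Fin c → 𝔽 q

vmul : (q : Q) {r c : ℕ} → Vec𝔽 q r → Mat q r c → Vec𝔽 q c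
vmul q x M j = sumF q (λ i → mulF q (x i) (M i j))

Code : Q → ℕ → Set₁
Code q N = Vec𝔽 q N → Set

rowSpace : (q : Q) {k N : ℕ} → Mat q k N → Code q N
rowSpace q {k} G x = Σ (Vec𝔽 q k) (λ u → ∀ j → x j ≡ vmul q u G j)

ExactlyOneNonzero : (q : Q) {n : ℕ} → Vec𝔽 q n → Set
ExactlyOneNonzero q v =
  Σ _ (λ i → ¬ (v i ≡ 0F q) × (∀ j → ¬ (v j ≡ 0F q) → j ≡ i))

IsMonomial : (q : Q) {N : ℕ} → Mat q N N → Set
IsMonomial q P =
  (∀ i → ExactlyOneNonzero q (λ j → P i j)) ×
  (∀ j → ExactlyOneNonzero q (λ i → P i j))

ImageUnder : (q : Q) {N : ℕ} → Code q N → Mat q N N → Code q N → Set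
ImageUnder q C P C' =
  ∀ y → (C' y → Σ _ (λ x → C x × (∀ j → y j ≡ vmul q x P j)))
      × ((x : Vec𝔽 q _) → C x → (∀ j → y j ≡ vmul q x P j) → C' y)

Equiv : (q : Q) {N : ℕ} → Code q N → Code q N → Set
Equiv q {N} C C' = Σ (Mat q N N) (λ P → IsMonomial q P × ImageUnder q C P C')

-- Double Toeplitz codes.  m = suc n, a b : F_q^{m-1} = Fin n → F_q,
-- with the paper's 1-based a_k (1 ≤ k ≤ m-1) being  a (k-1).

-- 1-based access a_k (k ≥ 1) to a vector of length n; only ever used
-- with 1 ≤ k ≤ n, the out-of-range default is irrelevant
at1 : (q : Q) {n : ℕ} → Vec𝔽 q n → ℕ → 𝔽 q
at1 q {zero} a k = 0F q
at1 q {suc n} a zero = 0F q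
at1 q {suc n} a (suc zero) = a zero
at1 q {suc n} a (suc (suc k)) = at1 q (λ i → a (suc i)) (suc k)

Toeplitz : (q : Q) {n : ℕ} → 𝔽 q → Vec𝔽 q n → Vec𝔽 q n → Mat q (suc n) (suc n)
Toeplitz q t a b i j with toℕ i <ᵇ toℕ j | toℕ j <ᵇ toℕ i
... | true  | _     = at1 q a (toℕ j ∸ toℕ i)
... | false | true  = at1 q b (toℕ i ∸ toℕ j)
... | false | false = t

identity : (q : Q) {m : ℕ} → Mat q m m
identity q {zero} ()
identity q {suc m} zero zero = 1F q
identity q {suc m} zero (suc j) = 0F q
identity q {suc m} (suc i) zero = 0F q
identity q {suc m} (suc i) (suc j) = identity q i j

hconcat : (q : Q) {r c₁ c₂ : ℕ} → Mat q r c₁ → Mat q r c₂ → Mat q r (c₁ + c₂)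
hconcat q {c₁ = c₁} A B i j with splitAt c₁ j
... | inj₁ j₁ = A i j₁
... | inj₂ j₂ = B i j₂

DT : (q : Q) {n : ℕ} → 𝔽 q → Vec𝔽 q n → Vec𝔽 q n → Code q (suc n + suc n)
DT q t a b = rowSpace q (hconcat q (identity q) (Toeplitz q t a b))

leadVec : (q : Q) {n : ℕ} → 𝔽 q → Vec𝔽 q n → Vec𝔽 q (suc n)
leadVec q t a zero = t
leadVec q t a (suc k) = a k

FirstNonzeroIsOne : (q : Q) {n : ℕ} → Vec𝔽 q n → Set
FirstNonzeroIsOne q v =
  ∀ i → ¬ (v i ≡ 0F q) → (∀ j → toℕ j < toℕ i → v j ≡ 0F q) → v i ≡ 1F q

{-# OPTIONS --safe #-}
-- Multiplying t, a and b by a nonzero scalar c multiplies the right half of the generator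
-- matrix (I | T(t,a,b)) by c, so the new code is the image of the old one under the invertible
-- diagonal matrix diag(1,…,1,c,…,c).  Taking c to be the inverse of the first nonzero
-- entry of (t, a₁, …, a_{m-1}) makes that entry 1.
module Submission where

open import Defs
open import Data.Nat using (ℕ; suc; zero; _<_; s≤s; z≤n; _<ᵇ_)
open import Data.Bool using (true; false)
open import Data.Fin using (Fin; zero; suc; toℕ; splitAt)
open import Data.Sum using (inj₁; inj₂)
open import Data.Product using (Σ; _×_; _,_)
open import Data.Vec.Functional using (_++_; replicate)
open import Function using (const)
open import Relation.Nullary using (Dec; yes; no; contradiction)
open import Relation.Binary.PropositionalEquality
  using (_≡_; _≢_; refl; sym; trans; cong; cong₂; module ≡-Reasoning)
open ≡-Reasoning

F3-cases : {P : F3 → Set} → P z3 → P o3 → P t3 → ∀ x → P x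
F3-cases p _ _ z3 = p
F3-cases _ p _ o3 = p
F3-cases _ _ p t3 = p

F4-cases : {P : F4 → Set} → P z4 → P o4 → P w4 → P w²4 → ∀ x → P x
F4-cases p _ _ _ z4 = p
F4-cases _ p _ _ o4 = p
F4-cases _ _ p _ w4 = p
F4-cases _ _ _ p w²4 = p

+-identityˡ : (q : Q) (x : 𝔽 q) → addF q (0F q) x ≡ x
+-identityˡ q3 x = refl
+-identityˡ q4 x = refl

+-identityʳ : (q : Q) (x : 𝔽 q) → addF q x (0F q) ≡ x
+-identityʳ q3 = F3-cases refl refl refl
+-identityʳ q4 = F4-cases refl refl refl refl

*-zeroˡ : (q : Q) (x : 𝔽 q) → mulF q (0F q) x ≡ 0F q
*-zeroˡ q3 x = refl
*-zeroˡ q4 x = refl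

*-identityˡ : (q : Q) (x : 𝔽 q) → mulF q (1F q) x ≡ x
*-identityˡ q3 x = refl
*-identityˡ q4 x = refl

*-comm : (q : Q) (x y : 𝔽 q) → mulF q x y ≡ mulF q y x
*-comm q3 = F3-cases (F3-cases refl refl refl) (F3-cases refl refl refl) (F3-cases refl refl refl)
*-comm q4 = F4-cases (F4-cases refl refl refl refl) (F4-cases refl refl refl refl)
                     (F4-cases refl refl refl refl) (F4-cases refl refl refl refl)

*-assoc : (q : Q) (x y z : 𝔽 q) → mulF q (mulF q x y) z ≡ mulF q x (mulF q y z)
*-assoc q3 z3 y z = refl
*-assoc q3 o3 y z = refl
*-assoc q3 t3 = F3-cases (λ _ → refl) (λ _ → refl) (F3-cases refl refl refl)
*-assoc q4 z4 y z = refl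
*-assoc q4 o4 y z = refl
*-assoc q4 w4 = F4-cases (λ _ → refl) (λ _ → refl) (F4-cases refl refl refl refl) (F4-cases refl refl refl refl)
*-assoc q4 w²4 = F4-cases (λ _ → refl) (λ _ → refl) (F4-cases refl refl refl refl) (F4-cases refl refl refl refl)

*-distribˡ-+ : (q : Q) (c x y : 𝔽 q) → mulF q c (addF q x y) ≡ addF q (mulF q c x) (mulF q c y)
*-distribˡ-+ q3 z3 x y = refl
*-distribˡ-+ q3 o3 x y = refl
*-distribˡ-+ q3 t3 = F3-cases (F3-cases refl refl refl) (F3-cases refl refl refl) (F3-cases refl refl refl)
*-distribˡ-+ q4 z4 x y = refl
*-distribˡ-+ q4 o4 x y = refl
*-distribˡ-+ q4 w4 = F4-cases (F4-cases refl refl refl refl) (F4-cases refl refl refl refl)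
                              (F4-cases refl refl refl refl) (F4-cases refl refl refl refl)
*-distribˡ-+ q4 w²4 = F4-cases (F4-cases refl refl refl refl) (F4-cases refl refl refl refl)
                               (F4-cases refl refl refl refl) (F4-cases refl refl refl refl)

-- In F₃ every nonzero element is its own inverse; 0⁻¹ = 0 is a junk value.
_⁻¹ : {q : Q} → 𝔽 q → 𝔽 q
_⁻¹ {q3} x = x
_⁻¹ {q4} z4 = z4
_⁻¹ {q4} o4 = o4
_⁻¹ {q4} w4 = w²4
_⁻¹ {q4} w²4 = w4

*-inverseˡ : (q : Q) (x : 𝔽 q) → x ≢ 0F q → mulF q (x ⁻¹) x ≡ 1F q
*-inverseˡ q3 z3 x≢0 = contradiction refl x≢0
*-inverseˡ q3 o3 _ = refl
*-inverseˡ q3 t3 _ = refl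
*-inverseˡ q4 z4 x≢0 = contradiction refl x≢0
*-inverseˡ q4 o4 _ = refl
*-inverseˡ q4 w4 _ = refl
*-inverseˡ q4 w²4 _ = refl

1≢0 : (q : Q) → 1F q ≢ 0F q
1≢0 q3 ()
1≢0 q4 ()

≡0F? : (q : Q) (x : 𝔽 q) → Dec (x ≡ 0F q)
≡0F? q3 = F3-cases (yes refl) (no λ ()) (no λ ())
≡0F? q4 = F4-cases (yes refl) (no λ ()) (no λ ()) (no λ ())

*-zeroʳ : (q : Q) (x : 𝔽 q) → mulF q x (0F q) ≡ 0F q
*-zeroʳ q x = trans (*-comm q x (0F q)) (*-zeroˡ q x)

x*yz≡y*xz : (q : Q) (x y z : 𝔽 q) → mulF q x (mulF q y z) ≡ mulF q y (mulF q x z)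
x*yz≡y*xz q x y z = begin
  mulF q x (mulF q y z) ≡⟨ sym (*-assoc q x y z) ⟩
  mulF q (mulF q x y) z ≡⟨ cong (λ xy → mulF q xy z) (*-comm q x y) ⟩
  mulF q (mulF q y x) z ≡⟨ *-assoc q y x z ⟩
  mulF q y (mulF q x z) ∎

⁻¹≢0 : (q : Q) (x : 𝔽 q) → x ≢ 0F q → x ⁻¹ ≢ 0F q
⁻¹≢0 q x x≢0 x⁻¹≡0 = 1≢0 q (begin
  1F q                ≡⟨ sym (*-inverseˡ q x x≢0) ⟩
  mulF q (x ⁻¹) x     ≡⟨ cong (λ y → mulF q y x) x⁻¹≡0 ⟩
  mulF q (0F q) x     ≡⟨ *-zeroˡ q x ⟩
  0F q                ∎)

*-cancelˡ-≡0 : (q : Q) (c x : 𝔽 q) → c ≢ 0F q → mulF q c x ≡ 0F q → x ≡ 0F q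
*-cancelˡ-≡0 q c x c≢0 cx≡0 = begin
  x                          ≡⟨ sym (*-identityˡ q x) ⟩
  mulF q (1F q) x            ≡⟨ cong (λ y → mulF q y x) (sym (*-inverseˡ q c c≢0)) ⟩
  mulF q (mulF q (c ⁻¹) c) x ≡⟨ *-assoc q (c ⁻¹) c x ⟩
  mulF q (c ⁻¹) (mulF q c x) ≡⟨ cong (mulF q (c ⁻¹)) cx≡0 ⟩
  mulF q (c ⁻¹) (0F q)       ≡⟨ *-zeroʳ q (c ⁻¹) ⟩
  0F q                       ∎

*-distribˡ-sumF : (q : Q) {n : ℕ} (c : 𝔽 q) (f : Vec𝔽 q n) →
  mulF q c (sumF q f) ≡ sumF q (λ i → mulF q c (f i))
*-distribˡ-sumF q {zero} c f = *-zeroʳ q c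
*-distribˡ-sumF q {suc n} c f = begin
  mulF q c (addF q (f zero) (sumF q (λ i → f (suc i))))
    ≡⟨ *-distribˡ-+ q c (f zero) _ ⟩
  addF q (mulF q c (f zero)) (mulF q c (sumF q (λ i → f (suc i))))
    ≡⟨ cong (addF q _) (*-distribˡ-sumF q c (λ i → f (suc i))) ⟩
  addF q (mulF q c (f zero)) (sumF q (λ i → mulF q c (f (suc i)))) ∎

sumF-cong : (q : Q) {n : ℕ} {f g : Vec𝔽 q n} → (∀ i → f i ≡ g i) → sumF q f ≡ sumF q g
sumF-cong q {zero} f≗g = refl
sumF-cong q {suc n} f≗g = cong₂ (addF q) (f≗g zero) (sumF-cong q (λ i → f≗g (suc i)))

sumF-0 : (q : Q) {n : ℕ} (f : Vec𝔽 q n) → (∀ i → f i ≡ 0F q) → sumF q f ≡ 0F q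
sumF-0 q {zero} f f≡0 = refl
sumF-0 q {suc n} f f≡0 =
  trans (cong₂ (addF q) (f≡0 zero) (sumF-0 q (λ i → f (suc i)) (λ i → f≡0 (suc i))))
        (+-identityˡ q (0F q))

identity-diag : (q : Q) {m : ℕ} (i : Fin m) → identity q i i ≡ 1F q
identity-diag q zero = refl
identity-diag q (suc i) = identity-diag q i

identity-≢0⇒≡ : (q : Q) {m : ℕ} (i j : Fin m) → identity q i j ≢ 0F q → i ≡ j
identity-≢0⇒≡ q zero zero _ = refl
identity-≢0⇒≡ q zero (suc j) I≢0 = contradiction refl I≢0
identity-≢0⇒≡ q (suc i) zero I≢0 = contradiction refl I≢0
identity-≢0⇒≡ q (suc i) (suc j) I≢0 = cong suc (identity-≢0⇒≡ q i j I≢0)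

vmul-identity : (q : Q) {m : ℕ} (x : Vec𝔽 q m) (j : Fin m) → vmul q x (identity q) j ≡ x j
vmul-identity q {suc m} x zero = begin
  addF q (mulF q (x zero) (1F q)) (sumF q (λ i → mulF q (x (suc i)) (0F q)))
    ≡⟨ cong₂ (addF q) (trans (*-comm q (x zero) (1F q)) (*-identityˡ q (x zero)))
                      (sumF-0 q _ (λ i → *-zeroʳ q (x (suc i)))) ⟩
  addF q (x zero) (0F q)
    ≡⟨ +-identityʳ q (x zero) ⟩
  x zero ∎
vmul-identity q {suc m} x (suc j) = begin
  addF q (mulF q (x zero) (0F q)) (vmul q (λ i → x (suc i)) (identity q) j)
    ≡⟨ cong₂ (addF q) (*-zeroʳ q (x zero)) (vmul-identity q (λ i → x (suc i)) j) ⟩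
  addF q (0F q) (x (suc j))
    ≡⟨ +-identityˡ q (x (suc j)) ⟩
  x (suc j) ∎

ScaledColumns : (q : Q) {r c : ℕ} → Vec𝔽 q c → Mat q r c → Mat q r c → Set
ScaledColumns q d G G' = ∀ i j → G' i j ≡ mulF q (d j) (G i j)

vmul-scaledColumns : (q : Q) {r c : ℕ} {d : Vec𝔽 q c} {G G' : Mat q r c} →
  ScaledColumns q d G G' → (x : Vec𝔽 q r) (j : Fin c) →
  vmul q x G' j ≡ mulF q (d j) (vmul q x G j)
vmul-scaledColumns q {d = d} {G} {G'} scaled x j = begin
  sumF q (λ i → mulF q (x i) (G' i j))
    ≡⟨ sumF-cong q (λ i → trans (cong (mulF q (x i)) (scaled i j)) (x*yz≡y*xz q (x i) (d j) (G i j))) ⟩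
  sumF q (λ i → mulF q (d j) (mulF q (x i) (G i j)))
    ≡⟨ sym (*-distribˡ-sumF q (d j) (λ i → mulF q (x i) (G i j))) ⟩
  mulF q (d j) (vmul q x G j) ∎

hconcat-scaledColumns : (q : Q) {r c₁ c₂ : ℕ} {d₁ : Vec𝔽 q c₁} {d₂ : Vec𝔽 q c₂}
  {A A' : Mat q r c₁} {B B' : Mat q r c₂} →
  ScaledColumns q d₁ A A' → ScaledColumns q d₂ B B' →
  ScaledColumns q (d₁ ++ d₂) (hconcat q A B) (hconcat q A' B')
hconcat-scaledColumns q {c₁ = c₁} scaledA scaledB i j with splitAt c₁ j
... | inj₁ j₁ = scaledA i j₁
... | inj₂ j₂ = scaledB i j₂

++-≢0 : (q : Q) {m n : ℕ} (d₁ : Vec𝔽 q m) (d₂ : Vec𝔽 q n) →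
  (∀ i → d₁ i ≢ 0F q) → (∀ j → d₂ j ≢ 0F q) → ∀ k → (d₁ ++ d₂) k ≢ 0F q
++-≢0 q {m} d₁ d₂ d₁≢0 d₂≢0 k with splitAt m k
... | inj₁ i = d₁≢0 i
... | inj₂ j = d₂≢0 j

diagonal : (q : Q) {m : ℕ} → Vec𝔽 q m → Mat q m m
diagonal q d i j = mulF q (d j) (identity q i j)

vmul-diagonal : (q : Q) {m : ℕ} (d x : Vec𝔽 q m) (j : Fin m) →
  vmul q x (diagonal q d) j ≡ mulF q (d j) (x j)
vmul-diagonal q d x j =
  trans (vmul-scaledColumns q {d = d} {identity q} {diagonal q d} (λ _ _ → refl) x j) (cong (mulF q (d j)) (vmul-identity q x j))

diagonal-diag : (q : Q) {m : ℕ} (d : Vec𝔽 q m) (i : Fin m) → diagonal q d i i ≡ d i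
diagonal-diag q d i =
  trans (cong (mulF q (d i)) (identity-diag q i)) (trans (*-comm q (d i) (1F q)) (*-identityˡ q (d i)))

diagonal-≢0⇒≡ : (q : Q) {m : ℕ} (d : Vec𝔽 q m) (i j : Fin m) → diagonal q d i j ≢ 0F q → i ≡ j
diagonal-≢0⇒≡ q d i j D≢0 = identity-≢0⇒≡ q i j (λ I≡0 →
  D≢0 (trans (cong (mulF q (d j)) I≡0) (*-zeroʳ q (d j))))

diagonal-isMonomial : (q : Q) {m : ℕ} (d : Vec𝔽 q m) → (∀ i → d i ≢ 0F q) →
  IsMonomial q (diagonal q d)
diagonal-isMonomial q d d≢0 =
  (λ i → i , diag≢0 i , λ j D≢0 → sym (diagonal-≢0⇒≡ q d i j D≢0)) ,
  (λ j → j , diag≢0 j , λ i D≢0 → diagonal-≢0⇒≡ q d i j D≢0)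
  where
  diag≢0 : ∀ i → diagonal q d i i ≢ 0F q
  diag≢0 i D≡0 = d≢0 i (trans (sym (diagonal-diag q d i)) D≡0)

rowSpace-scaledColumns-Equiv : (q : Q) {k N : ℕ} {G G' : Mat q k N} (d : Vec𝔽 q N) →
  (∀ j → d j ≢ 0F q) → ScaledColumns q d G G' → Equiv q (rowSpace q G) (rowSpace q G')
rowSpace-scaledColumns-Equiv q {G = G} {G'} d d≢0 scaled =
  diagonal q d , diagonal-isMonomial q d d≢0 , λ y → image y , preimage y
  where
  image : ∀ y → rowSpace q G' y →
    Σ _ (λ x → rowSpace q G x × (∀ j → y j ≡ vmul q x (diagonal q d) j))
  image y (u , y≡uG') = vmul q u G , (u , λ _ → refl) , λ j → begin
    y j                                ≡⟨ y≡uG' j ⟩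
    vmul q u G' j                      ≡⟨ vmul-scaledColumns q scaled u j ⟩
    mulF q (d j) (vmul q u G j)        ≡⟨ sym (vmul-diagonal q d (vmul q u G) j) ⟩
    vmul q (vmul q u G) (diagonal q d) j ∎

  preimage : ∀ y x → rowSpace q G x → (∀ j → y j ≡ vmul q x (diagonal q d) j) → rowSpace q G' y
  preimage y x (u , x≡uG) y≡xD = u , λ j → begin
    y j                                ≡⟨ y≡xD j ⟩
    vmul q x (diagonal q d) j          ≡⟨ vmul-diagonal q d x j ⟩
    mulF q (d j) (x j)                 ≡⟨ cong (mulF q (d j)) (x≡uG j) ⟩
    mulF q (d j) (vmul q u G j)        ≡⟨ sym (vmul-scaledColumns q scaled u j) ⟩
    vmul q u G' j                      ∎

scale : (q : Q) {n : ℕ} → 𝔽 q → Vec𝔽 q n → Vec𝔽 q n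
scale q c a k = mulF q c (a k)

at1-scale : (q : Q) {n : ℕ} (c : 𝔽 q) (a : Vec𝔽 q n) (k : ℕ) →
  at1 q (scale q c a) k ≡ mulF q c (at1 q a k)
at1-scale q {zero} c a k = sym (*-zeroʳ q c)
at1-scale q {suc n} c a zero = sym (*-zeroʳ q c)
at1-scale q {suc n} c a (suc zero) = refl
at1-scale q {suc n} c a (suc (suc k)) = at1-scale q c (λ i → a (suc i)) (suc k)

Toeplitz-scale : (q : Q) {n : ℕ} (c t : 𝔽 q) (a b : Vec𝔽 q n) →
  ScaledColumns q (const c) (Toeplitz q t a b) (Toeplitz q (mulF q c t) (scale q c a) (scale q c b))
Toeplitz-scale q c t a b i j with toℕ i <ᵇ toℕ j | toℕ j <ᵇ toℕ i
... | true  | _     = at1-scale q c a _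
... | false | true  = at1-scale q c b _
... | false | false = refl

DT-scale-Equiv : (q : Q) {n : ℕ} (c t : 𝔽 q) (a b : Vec𝔽 q n) → c ≢ 0F q →
  Equiv q (DT q t a b) (DT q (mulF q c t) (scale q c a) (scale q c b))
DT-scale-Equiv q {n} c t a b c≢0 =
  rowSpace-scaledColumns-Equiv q (replicate (suc n) (1F q) ++ replicate (suc n) c)
    (++-≢0 q (replicate (suc n) (1F q)) (replicate (suc n) c) (λ _ → 1≢0 q) (λ _ → c≢0))
    (hconcat-scaledColumns q (λ i j → sym (*-identityˡ q (identity q i j))) (Toeplitz-scale q c t a b))

-- 1 when v is zero, so that its inverse is always a valid scaling factor.
firstNonzero : (q : Q) {n : ℕ} → Vec𝔽 q n → 𝔽 q
firstNonzero q {zero} v = 1F q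
firstNonzero q {suc n} v with ≡0F? q (v zero)
... | yes _ = firstNonzero q (λ i → v (suc i))
... | no _  = v zero

firstNonzero-≢0 : (q : Q) {n : ℕ} (v : Vec𝔽 q n) → firstNonzero q v ≢ 0F q
firstNonzero-≢0 q {zero} v = 1≢0 q
firstNonzero-≢0 q {suc n} v with ≡0F? q (v zero)
... | yes _   = firstNonzero-≢0 q (λ i → v (suc i))
... | no v₀≢0 = v₀≢0

firstNonzero-at : (q : Q) {n : ℕ} (v : Vec𝔽 q n) (i : Fin n) → v i ≢ 0F q →
  (∀ j → toℕ j < toℕ i → v j ≡ 0F q) → v i ≡ firstNonzero q v
firstNonzero-at q v zero vᵢ≢0 _ with ≡0F? q (v zero)
... | yes v₀≡0 = contradiction v₀≡0 vᵢ≢0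
... | no _     = refl
firstNonzero-at q v (suc i) vᵢ≢0 before with ≡0F? q (v zero)
... | yes _    = firstNonzero-at q (λ k → v (suc k)) i vᵢ≢0 (λ j j<i → before (suc j) (s≤s j<i))
... | no v₀≢0  = contradiction (before zero (s≤s z≤n)) v₀≢0

FirstNonzeroIsOne-normalise : (q : Q) {n : ℕ} (v w : Vec𝔽 q n) →
  (∀ i → w i ≡ mulF q (firstNonzero q v ⁻¹) (v i)) → FirstNonzeroIsOne q w
FirstNonzeroIsOne-normalise q v w w≡cv i wᵢ≢0 before = begin
  w i                   ≡⟨ w≡cv i ⟩
  mulF q c (v i)        ≡⟨ cong (mulF q c) (firstNonzero-at q v i vᵢ≢0 v-before) ⟩
  mulF q c f            ≡⟨ *-inverseˡ q f (firstNonzero-≢0 q v) ⟩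
  1F q                  ∎
  where
  f = firstNonzero q v
  c = f ⁻¹

  vᵢ≢0 : v i ≢ 0F q
  vᵢ≢0 vᵢ≡0 = wᵢ≢0 (trans (w≡cv i) (trans (cong (mulF q c) vᵢ≡0) (*-zeroʳ q c)))

  v-before : ∀ j → toℕ j < toℕ i → v j ≡ 0F q
  v-before j j<i = *-cancelˡ-≡0 q c (v j) (⁻¹≢0 q f (firstNonzero-≢0 q v))
                     (trans (sym (w≡cv j)) (before j j<i))

lemma5p3 : (q : Q) (n : ℕ) (t : 𝔽 q) (a b : Vec𝔽 q n) →
    Σ (𝔽 q) (λ t' → Σ (Vec𝔽 q n) (λ a' → Σ (Vec𝔽 q n) (λ b' →
      Equiv q (DT q t a b) (DT q t' a' b')
      × FirstNonzeroIsOne q (leadVec q t' a'))))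
lemma5p3 q n t a b =
  mulF q c t , scale q c a , scale q c b ,
  DT-scale-Equiv q c t a b (⁻¹≢0 q f (firstNonzero-≢0 q (leadVec q t a))) ,
  FirstNonzeroIsOne-normalise q (leadVec q t a) (leadVec q (mulF q c t) (scale q c a)) leadVec-scale
  where
  f = firstNonzero q (leadVec q t a)
  c = f ⁻¹

  leadVec-scale : ∀ i → leadVec q (mulF q c t) (scale q c a) i ≡ mulF q c (leadVec q t a i)
  leadVec-scale zero    = refl
  leadVec-scale (suc i) = refl
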